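{- Let $\mathcal{L}=(L,\leq)$ be a finite congruence-uniform lattice with $n$ atoms. Then the subposet $(\mathrm{Nex}(\mathcal{L}),\leq)$ of $\mathcal{L}$ is isomorphic to the Boolean lattice $\mathrm{Bool}(n)$.
   Context: A finite lattice is congruence-uniform if the map $j\mapsto\mathrm{cg}(j_*,j)$ from join-irreducible elements to join-irreducible congruences is a bijection for both $\mathcal{L}$ and its dual, where $j_*$ is the unique lower cover of $j$ and $\mathrm{cg}(u,v)$ is the finest congruence identifying $u$ and $v$. Such lattices are semidistributive, so every element $x$ has a canonical join representation $\Gamma(x)$: a set with join $x$ that is irredundant (no proper subset has join $x$) and refines every other irredundant join representation $X'$ of $x$ (each element of $\Gamma(x)$ lies below some element of $X'$). $\mathrm{Atoms}(\mathcal{L})$ is the set of elements covering $\hat0$. The Boolean nexus is $\mathrm{Nex}(\mathcal{L})=\{x\in L\mid\Gamma(x)\subseteq\mathrm{Atoms}(\mathcal{L})\}$. $\mathrm{Bool}(n)=(\wp(\{1,\dots,n\}),\subseteq)$. -}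

module Defs where

open import Data.Bool using (Bool; T)
open import Data.Nat using (ℕ)
open import Data.Empty using (⊥)
open import Data.Product using (Σ; Σ-syntax; ∃; ∃-syntax; _×_)
open import Data.Sum using (_⊎_)
open import Data.List using (List; length)
open import Data.List.Membership.Propositional using (_∈_)
open import Data.List.Relation.Unary.Unique.Propositional using (Unique)
open import Data.Fin.Subset using (Subset; _⊆_)
open import Relation.Nullary using (¬_)
open import Relation.Binary using (Rel; Decidable; Minimum; Maximum)
open import Relation.Binary.PropositionalEquality using (_≡_; _≢_)
open import Relation.Binary.Lattice.Structures using (IsLattice)
open import Function using (flip)
open import Function.Bundles using (_⇔_)

-- A finite
-- (nonempty) lattice is bounded; we record ⊥ and ⊤ explicitly, as well as
-- decidability of ≤ and of equality (automatic for finite lattices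
-- classically).

record FinLattice : Set₁ where
  field
    Carrier   : Set
    _≤_       : Rel Carrier _
    _∨_       : Carrier → Carrier → Carrier
    _∧_       : Carrier → Carrier → Carrier
    isLattice : IsLattice _≡_ _≤_ _∨_ _∧_
    ⊥L        : Carrier
    ⊤L        : Carrier
    ⊥L-min    : Minimum _≤_ ⊥L
    ⊤L-max    : Maximum _≤_ ⊤L
    elems     : List Carrier
    complete  : ∀ x → x ∈ elems
    _≤?_      : Decidable _≤_
    _≟_       : Decidable (_≡_ {A = Carrier})

module _ (L : FinLattice) where
  open FinLattice L

  -- Covering relation with respect to an order R (R = _≤_ or its dual).
  -- x ⋖ y : y covers x.
  CoversR : Rel Carrier _ → Carrier → Carrier → Set
  CoversR R x y = R x y × x ≢ y ×
    (∀ z → R x z → R z y → z ≡ x ⊎ z ≡ y)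

  -- j has unique lower cover js (w.r.t. R): j is R-join-irreducible
  -- and js = j_*.
  UniqueLowerCoverR : Rel Carrier _ → Carrier → Carrier → Set
  UniqueLowerCoverR R j js = CoversR R js j × (∀ k → CoversR R k j → k ≡ js)

  Relᵇ : Set
  Relᵇ = Carrier → Carrier → Bool

  IsCongruence : Relᵇ → Set
  IsCongruence θ =
    (∀ x → T (θ x x)) ×
    (∀ x y → T (θ x y) → T (θ y x)) ×
    (∀ x y z → T (θ x y) → T (θ y z) → T (θ x z)) ×
    (∀ x y u v → T (θ x y) → T (θ u v) → T (θ (x ∨ u) (y ∨ v))) ×
    (∀ x y u v → T (θ x y) → T (θ u v) → T (θ (x ∧ u) (y ∧ v)))

  _⊑_ : Relᵇ → Relᵇ → Set
  θ ⊑ ψ = ∀ x y → T (θ x y) → T (ψ x y)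

  _≈ᶜ_ : Relᵇ → Relᵇ → Set
  θ ≈ᶜ ψ = θ ⊑ ψ × ψ ⊑ θ

  ConCovers : Relᵇ → Relᵇ → Set
  ConCovers ψ θ = IsCongruence ψ × IsCongruence θ × ψ ⊑ θ × ¬ (θ ⊑ ψ) ×
    (∀ φ → IsCongruence φ → ψ ⊑ φ → φ ⊑ θ → φ ≈ᶜ ψ ⊎ φ ≈ᶜ θ)

  JICon : Relᵇ → Set
  JICon θ = IsCongruence θ ×
    (Σ[ ψ ∈ Relᵇ ] ConCovers ψ θ × (∀ φ → ConCovers φ θ → φ ≈ᶜ ψ))

  IsCg : Relᵇ → Carrier → Carrier → Set
  IsCg θ u v = IsCongruence θ × T (θ u v) ×
    (∀ ψ → IsCongruence ψ → T (ψ u v) → θ ⊑ ψ)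

  -- The map j ↦ cg(j_* , j) from join-irreducibles (w.r.t. order R) to
  -- join-irreducible congruences is a (well-defined) bijection.
  CgBijection : Rel Carrier _ → Set
  CgBijection R =
    (∀ j js → UniqueLowerCoverR R j js →
       Σ[ θ ∈ Relᵇ ] IsCg θ js j × JICon θ) ×
    (∀ j js k ks θ ψ → UniqueLowerCoverR R j js → UniqueLowerCoverR R k ks →
       IsCg θ js j → IsCg ψ ks k → θ ≈ᶜ ψ → j ≡ k) ×
    (∀ θ → JICon θ →
       Σ[ j ∈ Carrier ] Σ[ js ∈ Carrier ] UniqueLowerCoverR R j js × IsCg θ js j)

  CongruenceUniform : Set
  CongruenceUniform = CgBijection _≤_ × CgBijection (flip _≤_)

  _⋖_ : Carrier → Carrier → Set
  _⋖_ = CoversR _≤_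

  Atom : Carrier → Set
  Atom a = ⊥L ⋖ a

  HasNAtoms : ℕ → Set
  HasNAtoms n = Σ[ as ∈ List Carrier ]
    Unique as × (∀ a → (a ∈ as ⇔ Atom a)) × length as ≡ n

  SubsetL : Set
  SubsetL = Carrier → Bool

  JoinRep : SubsetL → Carrier → Set
  JoinRep A x = (∀ a → T (A a) → a ≤ x) ×
    (∀ u → (∀ a → T (A a) → a ≤ u) → x ≤ u)

  ProperSubset : SubsetL → SubsetL → Set
  ProperSubset B A = (∀ a → T (B a) → T (A a)) × (∃[ a ] T (A a) × ¬ T (B a))

  Irredundant : SubsetL → Carrier → Set
  Irredundant A x = JoinRep A x × (∀ B → ProperSubset B A → ¬ JoinRep B x)

  CanonicalJoinRep : SubsetL → Carrier → Set
  CanonicalJoinRep A x = Irredundant A x ×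
    (∀ X′ → Irredundant X′ x → ∀ a → T (A a) → ∃[ b ] T (X′ b) × a ≤ b)

  Nex : Carrier → Set
  Nex x = Σ[ Γ ∈ SubsetL ] CanonicalJoinRep Γ x × (∀ a → T (Γ a) → Atom a)

  record NexIsoBool (n : ℕ) : Set where
    field
      to       : (x : Carrier) → Nex x → Subset n
      from     : Subset n → Carrier
      from-nex : ∀ S → Nex (from S)
      from-to  : ∀ x (p : Nex x) → from (to x p) ≡ x
      to-from  : ∀ S (p : Nex (from S)) → to (from S) p ≡ S
      mono     : ∀ x y (p : Nex x) (q : Nex y) → x ≤ y → to x p ⊆ to y q
      reflect  : ∀ x y (p : Nex x) (q : Nex y) → to x p ⊆ to y q → x ≤ y

-- In a congruence-uniform lattice every atom a is join-prime.  If a ≰ x and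
-- a ≰ y, enlarge x and y to elements m and m′ that are maximal with a ≰ m,
-- a ≰ m′.  Such an m is meet-irreducible with unique upper cover a ∨ m, and
-- since a ∧ m = ⊥ a congruence collapses a ∨ m onto m iff it collapses a onto
-- ⊥, so cg(m , a ∨ m) = cg(⊥ , a) = cg(m′ , a ∨ m′).  Injectivity of the dual
-- map j ↦ cg(j , j^*) gives m = m′, hence x ∨ y ≤ m and a ≰ x ∨ y.
-- With join-prime atoms, the canonical join representation of a join of atoms
-- is the set of all atoms below it, so Nex(L) consists exactly of the joins of
-- sets of atoms, and distinct sets of atoms have distinct joins.
module Submission where

open import Defs
open import Data.Bool using (Bool; T)
open import Data.Bool.Properties using (T-≡)
open import Data.Empty using (⊥-elim)
open import Data.Fin using (Fin; zero; suc)
open import Data.Fin.Subset using (Subset; _∈_; _⊆_)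
open import Data.Fin.Subset.Properties using (_∈?_; ⊆-antisym)
open import Data.List using (List; []; _∷_; length; lookup; map; filter; allFin)
open import Data.List.Membership.Propositional using (lose) renaming (_∈_ to _∈ₗ_)
open import Data.List.Membership.Propositional.Properties
  using (∈-lookup; ∈-allFin; ∈-map⁺; ∈-map⁻; ∈-filter⁺; ∈-filter⁻)
import Data.List.Relation.Unary.All as All
open import Data.List.Relation.Unary.Any using (here; there; index; any?; satisfied)
open import Data.List.Relation.Unary.Any.Properties using (lookup-index)
open import Data.List.Relation.Unary.AllPairs using (_∷_)
open import Data.List.Relation.Unary.Unique.Propositional using (Unique)
open import Data.Nat using (ℕ; suc; _<_; s≤s; z≤n) renaming (_≤_ to _≤ℕ_)
open import Data.Nat.Induction using (<-wellFounded)
open import Data.Nat.Properties using (m≤n⇒m≤1+n; m<n⇒m<1+n)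
open import Data.Product using (∃-syntax; _×_; _,_; proj₁; proj₂)
open import Data.Sum using (_⊎_; inj₁; inj₂)
open import Data.Vec using (tabulate)
open import Data.Vec.Properties using (lookup∘tabulate; []=⇒lookup; lookup⇒[]=)
open import Function using (flip; _∘_)
open import Function.Bundles using (Equivalence; _⇔_)
open import Induction.WellFounded using (Acc; acc)
open import Relation.Binary.Lattice.Bundles using (Lattice)
open import Relation.Binary.Lattice.Structures using (IsLattice)
open import Relation.Binary.PropositionalEquality
  using (_≡_; _≢_; refl; sym; trans; cong; subst; subst₂)
open import Relation.Nullary using (¬_; yes; no; ¬?)
open import Relation.Nullary.Decidable using (⌊_⌋; toWitness; fromWitness; _×-dec_; T?)
open import Relation.Unary using (Decidable)
import Data.List.Membership.DecPropositional as DecMembership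

lookup-injective : ∀ {A : Set} {xs : List A} → Unique xs →
                   ∀ i j → lookup xs i ≡ lookup xs j → i ≡ j
lookup-injective (_ ∷ _)     zero    zero    _  = refl
lookup-injective (x∉xs ∷ _) zero    (suc j) eq = ⊥-elim (All.lookup x∉xs (∈-lookup j) eq)
lookup-injective (x∉xs ∷ _) (suc i) zero    eq = ⊥-elim (All.lookup x∉xs (∈-lookup i) (sym eq))
lookup-injective (_ ∷ uniq)  (suc i) (suc j) eq = cong suc (lookup-injective uniq i j eq)

∈-tabulate⁺ : ∀ {n} {f : Fin n → Bool} {i} → T (f i) → i ∈ tabulate f
∈-tabulate⁺ {f = f} {i} fi = lookup⇒[]= i _ (trans (lookup∘tabulate f i) (Equivalence.to T-≡ fi))

∈-tabulate⁻ : ∀ {n} {f : Fin n → Bool} {i} → i ∈ tabulate f → T (f i)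
∈-tabulate⁻ {f = f} {i} i∈ = Equivalence.from T-≡ (trans (sym (lookup∘tabulate f i)) ([]=⇒lookup i∈))

module _ (L : FinLattice) where
  open FinLattice L
  open IsLattice isLattice using (x≤x∨y; y≤x∨y; ∨-least; x∧y≤x; x∧y≤y)
    renaming (refl to ≤-refl; trans to ≤-trans; antisym to ≤-antisym)

  private
    lattice : Lattice _ _ _
    lattice = record { isLattice = isLattice }

  open import Relation.Binary.Lattice.Properties.Lattice lattice using (∧-absorbs-∨)
  open import Relation.Binary.Lattice.Properties.JoinSemilattice (Lattice.joinSemilattice lattice)
    using (x≤y⇒x∨y≈y)

  ⋁ : List Carrier → Carrier
  ⋁ []       = ⊥L
  ⋁ (x ∷ xs) = x ∨ ⋁ xs

  ⋁-upper : ∀ {x xs} → x ∈ₗ xs → x ≤ ⋁ xs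
  ⋁-upper (here refl)  = x≤x∨y _ _
  ⋁-upper (there x∈xs) = ≤-trans (⋁-upper x∈xs) (y≤x∨y _ _)

  ⋁-least : ∀ {u} xs → (∀ {x} → x ∈ₗ xs → x ≤ u) → ⋁ xs ≤ u
  ⋁-least []       _     = ⊥L-min _
  ⋁-least (x ∷ xs) bound = ∨-least (bound (here refl)) (⋁-least xs (bound ∘ there))

  Maximal : (Carrier → Set) → Carrier → Set
  Maximal P m = P m × (∀ {z} → m ≤ z → P z → z ≡ m)

  #above : Carrier → List Carrier → ℕ
  #above x [] = 0
  #above x (y ∷ ys) with x ≤? y
  ... | yes _ = suc (#above x ys)
  ... | no  _ = #above x ys

  #above-antitone : ∀ {x z} → x ≤ z → ∀ ys → #above z ys ≤ℕ #above x ys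
  #above-antitone x≤z [] = z≤n
  #above-antitone {x} {z} x≤z (y ∷ ys) with x ≤? y | z ≤? y
  ... | yes _   | yes _   = s≤s (#above-antitone x≤z ys)
  ... | yes _   | no  _   = m≤n⇒m≤1+n (#above-antitone x≤z ys)
  ... | no  x≰y | yes z≤y = ⊥-elim (x≰y (≤-trans x≤z z≤y))
  ... | no  _   | no  _   = #above-antitone x≤z ys

  #above-strict : ∀ {x z} → x ≤ z → ¬ z ≤ x → ∀ {ys} → x ∈ₗ ys → #above z ys < #above x ys
  #above-strict {x} {z} x≤z z≰x {x ∷ ys} (here refl) with x ≤? x | z ≤? x
  ... | _       | yes z≤x = ⊥-elim (z≰x z≤x)
  ... | yes _   | no  _   = s≤s (#above-antitone x≤z ys)
  ... | no  x≰x | no  _   = ⊥-elim (x≰x ≤-refl)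
  #above-strict {x} {z} x≤z z≰x {y ∷ ys} (there x∈ys) with x ≤? y | z ≤? y
  ... | yes _   | yes _   = s≤s (#above-strict x≤z z≰x x∈ys)
  ... | yes _   | no  _   = m<n⇒m<1+n (#above-strict x≤z z≰x x∈ys)
  ... | no  x≰y | yes z≤y = ⊥-elim (x≰y (≤-trans x≤z z≤y))
  ... | no  _   | no  _   = #above-strict x≤z z≰x x∈ys

  maximal-above : ∀ {P : Carrier → Set} → Decidable P → ∀ {b} → P b → ∃[ m ] b ≤ m × Maximal P m
  maximal-above {P} P? {b} = search b (<-wellFounded _)
    where
    search : ∀ x → Acc _<_ (#above x elems) → P x → ∃[ m ] x ≤ m × Maximal P m
    search x (acc smaller) px with any? (λ z → x ≤? z ×-dec ¬? (z ≟ x) ×-dec P? z) elems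
    ... | yes found =
      let (z , x≤z , z≢x , pz) = satisfied found
          z≰x = λ z≤x → z≢x (≤-antisym z≤x x≤z)
          (m , z≤m , maximal) = search z (smaller (#above-strict x≤z z≰x (complete x))) pz
      in m , ≤-trans x≤z z≤m , maximal
    ... | no none = x , ≤-refl , px , maximal
      where
      maximal : ∀ {z} → x ≤ z → P z → z ≡ x
      maximal {z} x≤z pz with z ≟ x
      ... | yes z≡x = z≡x
      ... | no  z≢x = ⊥-elim (none (lose (complete z) (x≤z , z≢x , pz)))

  atom-≤⇒≡ : ∀ {a b} → Atom L a → Atom L b → a ≤ b → a ≡ b
  atom-≤⇒≡ (_ , ⊥≢a , _) (_ , _ , between) a≤b with between _ (⊥L-min _) a≤b
  ... | inj₁ a≡⊥ = ⊥-elim (⊥≢a (sym a≡⊥))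
  ... | inj₂ a≡b = a≡b

  atom-≰⊥ : ∀ {a} → Atom L a → ¬ a ≤ ⊥L
  atom-≰⊥ (_ , ⊥≢a , _) a≤⊥ = ⊥≢a (≤-antisym (⊥L-min _) a≤⊥)

  atom-∧-≰ : ∀ {a m} → Atom L a → ¬ a ≤ m → a ∧ m ≡ ⊥L
  atom-∧-≰ {a} {m} (_ , _ , between) a≰m with between (a ∧ m) (⊥L-min _) (x∧y≤x a m)
  ... | inj₁ a∧m≡⊥ = a∧m≡⊥
  ... | inj₂ a∧m≡a = ⊥-elim (a≰m (subst (_≤ m) a∧m≡a (x∧y≤y a m)))

  maximal-≰-above : ∀ {a m z} → Maximal (λ w → ¬ a ≤ w) m → m ≤ z → z ≢ m → a ≤ z
  maximal-≰-above {a} {z = z} (_ , maximal) m≤z z≢m with a ≤? z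
  ... | yes a≤z = a≤z
  ... | no  a≰z = ⊥-elim (z≢m (maximal m≤z a≰z))

  maximal-≰-dualCover : ∀ {a m} → Maximal (λ w → ¬ a ≤ w) m →
                        UniqueLowerCoverR L (flip _≤_) m (a ∨ m)
  maximal-≰-dualCover {a} {m} max@(a≰m , _) = (y≤x∨y a m , a∨m≢m , between) , unique
    where
    a∨m≢m : a ∨ m ≢ m
    a∨m≢m a∨m≡m = a≰m (subst (a ≤_) a∨m≡m (x≤x∨y a m))

    between : ∀ z → z ≤ (a ∨ m) → m ≤ z → z ≡ a ∨ m ⊎ z ≡ m
    between z z≤a∨m m≤z with z ≟ m
    ... | yes z≡m = inj₂ z≡m
    ... | no  z≢m = inj₁ (≤-antisym z≤a∨m (∨-least (maximal-≰-above max m≤z z≢m) m≤z))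

    unique : ∀ k → CoversR L (flip _≤_) k m → k ≡ a ∨ m
    unique k (m≤k , k≢m , between-k)
      with between-k (a ∨ m) (∨-least (maximal-≰-above max m≤k k≢m) m≤k) (y≤x∨y a m)
    ... | inj₁ a∨m≡k = sym a∨m≡k
    ... | inj₂ a∨m≡m = ⊥-elim (a∨m≢m a∨m≡m)

  atom-collapse⇒cover-collapse : ∀ {θ a} m → IsCongruence L θ → T (θ a ⊥L) → T (θ (a ∨ m) m)
  atom-collapse⇒cover-collapse {θ} {a} m (θ-refl , _ , _ , θ-∨ , _) a~⊥ =
    subst (T ∘ θ (a ∨ m)) (x≤y⇒x∨y≈y (⊥L-min m)) (θ-∨ a ⊥L m m a~⊥ (θ-refl m))

  cover-collapse⇒atom-collapse : ∀ {θ a m} → Atom L a → ¬ a ≤ m → IsCongruence L θ →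
                                 T (θ (a ∨ m) m) → T (θ a ⊥L)
  cover-collapse⇒atom-collapse {θ} {a} {m} atom-a a≰m (θ-refl , _ , _ , _ , θ-∧) a∨m~m =
    subst₂ (λ u v → T (θ u v)) (∧-absorbs-∨ a m) (atom-∧-≰ atom-a a≰m)
      (θ-∧ a a (a ∨ m) m (θ-refl a) a∨m~m)

  cg-cover-≈ : ∀ {θ₁ θ₂ a m₁ m₂} → Atom L a → ¬ a ≤ m₁ → ¬ a ≤ m₂ →
               IsCg L θ₁ (a ∨ m₁) m₁ → IsCg L θ₂ (a ∨ m₂) m₂ → _≈ᶜ_ L θ₁ θ₂
  cg-cover-≈ {a = a} atom-a a≰m₁ a≰m₂ (isθ₁ , collapse₁ , finest₁) (isθ₂ , collapse₂ , finest₂) =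
    finest₁ _ isθ₂ (transfer a≰m₂ isθ₂ collapse₂) ,
    finest₂ _ isθ₁ (transfer a≰m₁ isθ₁ collapse₁)
    where
    transfer : ∀ {θ m m′} → ¬ a ≤ m → IsCongruence L θ →
               T (θ (a ∨ m) m) → T (θ (a ∨ m′) m′)
    transfer a≰m isθ =
      atom-collapse⇒cover-collapse _ isθ ∘ cover-collapse⇒atom-collapse atom-a a≰m isθ

  maximal-≰-unique : CongruenceUniform L → ∀ {a m₁ m₂} → Atom L a →
                     Maximal (λ w → ¬ a ≤ w) m₁ → Maximal (λ w → ¬ a ≤ w) m₂ → m₁ ≡ m₂
  maximal-≰-unique (_ , dual-cg , dual-cg-injective , _) {a} {m₁} {m₂} atom-a max₁ max₂ =
    let cover₁ = maximal-≰-dualCover max₁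
        cover₂ = maximal-≰-dualCover max₂
        (θ₁ , cg₁ , _) = dual-cg m₁ (a ∨ m₁) cover₁
        (θ₂ , cg₂ , _) = dual-cg m₂ (a ∨ m₂) cover₂
    in dual-cg-injective m₁ (a ∨ m₁) m₂ (a ∨ m₂) θ₁ θ₂ cover₁ cover₂ cg₁ cg₂
         (cg-cover-≈ atom-a (proj₁ max₁) (proj₁ max₂) cg₁ cg₂)

  AtomsJoinPrime : Set
  AtomsJoinPrime = ∀ {a x y} → Atom L a → a ≤ (x ∨ y) → a ≤ x ⊎ a ≤ y

  atoms-joinPrime : CongruenceUniform L → AtomsJoinPrime
  atoms-joinPrime cu {a} {x} {y} atom-a a≤x∨y with a ≤? x | a ≤? y
  ... | yes a≤x | _       = inj₁ a≤x
  ... | no  _   | yes a≤y = inj₂ a≤y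
  ... | no  a≰x | no  a≰y =
    let (m  , x≤m  , max)  = maximal-above (λ w → ¬? (a ≤? w)) a≰x
        (m′ , y≤m′ , max′) = maximal-above (λ w → ¬? (a ≤? w)) a≰y
        m′≡m = maximal-≰-unique cu atom-a max′ max
    in ⊥-elim (proj₁ max (≤-trans a≤x∨y (∨-least x≤m (subst (y ≤_) m′≡m y≤m′))))

  IsJoinOfAtoms : Carrier → Set
  IsJoinOfAtoms x = ∀ u → (∀ a → Atom L a → a ≤ x → a ≤ u) → x ≤ u

  nex⇒isJoinOfAtoms : ∀ {x} → Nex L x → IsJoinOfAtoms x
  nex⇒isJoinOfAtoms (Γ , (((Γ≤x , least) , _) , _) , Γ-atoms) u bound =
    least u (λ a a∈Γ → bound a (Γ-atoms a a∈Γ) (Γ≤x a a∈Γ))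

  module _ (joinPrime : AtomsJoinPrime) where

    atom-≤-⋁ : ∀ {a} → Atom L a → ∀ xs → a ≤ ⋁ xs → ∃[ x ] x ∈ₗ xs × a ≤ x
    atom-≤-⋁ atom-a []       a≤⊥ = ⊥-elim (atom-≰⊥ atom-a a≤⊥)
    atom-≤-⋁ atom-a (x ∷ xs) a≤x∨⋁xs with joinPrime atom-a a≤x∨⋁xs
    ... | inj₁ a≤x   = x , here refl , a≤x
    ... | inj₂ a≤⋁xs =
      let (y , y∈xs , a≤y) = atom-≤-⋁ atom-a xs a≤⋁xs in y , there y∈xs , a≤y

    atom-≤-joinRep : ∀ {a B x} → Atom L a → JoinRep L B x → a ≤ x → ∃[ b ] T (B b) × a ≤ b
    atom-≤-joinRep {a} {B} atom-a (_ , least) a≤x =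
      let x≤⋁Bs = least _ (λ b Bb → ⋁-upper (∈-filter⁺ B? (complete b) Bb))
          (b , b∈Bs , a≤b) = atom-≤-⋁ atom-a (filter B? elems) (≤-trans a≤x x≤⋁Bs)
      in b , proj₂ (∈-filter⁻ B? {xs = elems} b∈Bs) , a≤b
      where
      B? = T? ∘ B

    module _ (as : List Carrier) (atoms : ∀ a → a ∈ₗ as ⇔ Atom L a) where
      open DecMembership _≟_ using () renaming (_∈?_ to _∈ₗ?_)

      atomsBelow : Carrier → SubsetL L
      atomsBelow x a = ⌊ a ∈ₗ? as ×-dec a ≤? x ⌋

      isJoinOfAtoms⇒nex : ∀ {x} → IsJoinOfAtoms x → Nex L x
      isJoinOfAtoms⇒nex {x} joinOfAtoms =
        atomsBelow x , (((below , least) , irredundant) , refines) , isAtom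
        where
        isAtom : ∀ a → T (atomsBelow x a) → Atom L a
        isAtom a = Equivalence.to (atoms a) ∘ proj₁ ∘ toWitness

        below : ∀ a → T (atomsBelow x a) → a ≤ x
        below a = proj₂ ∘ toWitness

        least : ∀ u → (∀ a → T (atomsBelow x a) → a ≤ u) → x ≤ u
        least u bound = joinOfAtoms u λ a atom-a a≤x →
          bound a (fromWitness (Equivalence.from (atoms a) atom-a , a≤x))

        irredundant : ∀ B → ProperSubset L B (atomsBelow x) → ¬ JoinRep L B x
        irredundant B (B⊆ , a , a∈ , a∉B) joinRep =
          let (b , b∈B , a≤b) = atom-≤-joinRep (isAtom a a∈) joinRep (below a a∈)
              a≡b = atom-≤⇒≡ (isAtom a a∈) (isAtom b (B⊆ b b∈B)) a≤b
          in a∉B (subst (T ∘ B) (sym a≡b) b∈B)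

        refines : ∀ X′ → Irredundant L X′ x → ∀ a → T (atomsBelow x a) → ∃[ b ] T (X′ b) × a ≤ b
        refines X′ (joinRep , _) a a∈ = atom-≤-joinRep (isAtom a a∈) joinRep (below a a∈)

      module _ (unique : Unique as) where
        private
          n = length as

          atom : Fin n → Carrier
          atom = lookup as

          atom-isAtom : ∀ i → Atom L (atom i)
          atom-isAtom i = Equivalence.to (atoms _) (∈-lookup i)

          atom-index : ∀ {a} → Atom L a → ∃[ i ] a ≡ atom i
          atom-index {a} atom-a =
            let a∈as = Equivalence.from (atoms a) atom-a in index a∈as , lookup-index a∈as

        toSubset : Carrier → Subset n
        toSubset x = tabulate (λ i → ⌊ atom i ≤? x ⌋)

        ∈-toSubset⁺ : ∀ {i x} → atom i ≤ x → i ∈ toSubset x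
        ∈-toSubset⁺ = ∈-tabulate⁺ ∘ fromWitness

        ∈-toSubset⁻ : ∀ {i x} → i ∈ toSubset x → atom i ≤ x
        ∈-toSubset⁻ = toWitness ∘ ∈-tabulate⁻

        toSubset-mono : ∀ {x y} → x ≤ y → toSubset x ⊆ toSubset y
        toSubset-mono x≤y i∈x = ∈-toSubset⁺ (≤-trans (∈-toSubset⁻ i∈x) x≤y)

        toSubset-reflects : ∀ {x y} → IsJoinOfAtoms x → toSubset x ⊆ toSubset y → x ≤ y
        toSubset-reflects {x} {y} joinOfAtoms x⊆y = joinOfAtoms y λ a atom-a a≤x →
          let (i , a≡atom-i) = atom-index atom-a
              i∈x = ∈-toSubset⁺ (subst (_≤ x) a≡atom-i a≤x)
          in subst (_≤ y) (sym a≡atom-i) (∈-toSubset⁻ (x⊆y i∈x))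

        chosen : Subset n → List Carrier
        chosen S = map atom (filter (_∈? S) (allFin n))

        fromSubset : Subset n → Carrier
        fromSubset S = ⋁ (chosen S)

        atom-≤-fromSubset : ∀ {i S} → i ∈ S → atom i ≤ fromSubset S
        atom-≤-fromSubset {S = S} i∈S = ⋁-upper (∈-map⁺ atom (∈-filter⁺ (_∈? S) (∈-allFin _) i∈S))

        ∈-chosen⁻ : ∀ {a S} → a ∈ₗ chosen S → ∃[ i ] i ∈ S × a ≡ atom i
        ∈-chosen⁻ {S = S} a∈ =
          let (i , i∈ , a≡atom-i) = ∈-map⁻ atom a∈
          in i , proj₂ (∈-filter⁻ (_∈? S) {xs = allFin n} i∈) , a≡atom-i

        fromSubset-least : ∀ {S u} → (∀ {i} → i ∈ S → atom i ≤ u) → fromSubset S ≤ u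
        fromSubset-least {S} {u} bound = ⋁-least (chosen S) λ a∈ →
          let (i , i∈S , a≡atom-i) = ∈-chosen⁻ a∈
          in subst (_≤ u) (sym a≡atom-i) (bound i∈S)

        atom-≤-fromSubset⁻ : ∀ {i S} → atom i ≤ fromSubset S → i ∈ S
        atom-≤-fromSubset⁻ {i} {S} atom-i≤ =
          let (a , a∈ , atom-i≤a) = atom-≤-⋁ (atom-isAtom i) (chosen S) atom-i≤
              (j , j∈S , a≡atom-j) = ∈-chosen⁻ a∈
              atom-i≤atom-j = subst (atom i ≤_) a≡atom-j atom-i≤a
              i≡j = lookup-injective unique i j (atom-≤⇒≡ (atom-isAtom i) (atom-isAtom j) atom-i≤atom-j)
          in subst (_∈ S) (sym i≡j) j∈S

        fromSubset-isJoinOfAtoms : ∀ S → IsJoinOfAtoms (fromSubset S)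
        fromSubset-isJoinOfAtoms S u bound =
          fromSubset-least λ {i} i∈S → bound (atom i) (atom-isAtom i) (atom-≤-fromSubset i∈S)

        toSubset-fromSubset : ∀ S → toSubset (fromSubset S) ≡ S
        toSubset-fromSubset S =
          ⊆-antisym (atom-≤-fromSubset⁻ ∘ ∈-toSubset⁻) (∈-toSubset⁺ ∘ atom-≤-fromSubset)

        fromSubset-toSubset : ∀ {x} → IsJoinOfAtoms x → fromSubset (toSubset x) ≡ x
        fromSubset-toSubset {x} joinOfAtoms =
          ≤-antisym (fromSubset-least ∈-toSubset⁻)
                    (toSubset-reflects joinOfAtoms (subst (_ ∈_) (sym (toSubset-fromSubset (toSubset x)))))

        nexIsoBool : NexIsoBool L n
        nexIsoBool = record
          { to       = λ x _ → toSubset x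
          ; from     = fromSubset
          ; from-nex = isJoinOfAtoms⇒nex ∘ fromSubset-isJoinOfAtoms
          ; from-to  = λ _ → fromSubset-toSubset ∘ nex⇒isJoinOfAtoms
          ; to-from  = λ S _ → toSubset-fromSubset S
          ; mono     = λ _ _ _ _ → toSubset-mono
          ; reflect  = λ _ _ p _ → toSubset-reflects (nex⇒isJoinOfAtoms p)
          }

proposition5p4 : (L : FinLattice) → CongruenceUniform L →
    (n : ℕ) → HasNAtoms L n → NexIsoBool L n
proposition5p4 L cu .(length as) (as , unique , atoms , refl) =
  nexIsoBool L (atoms-joinPrime L cu) as atoms unique
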